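{- Let $G^{(0)}$ be a simple undirected graph on an $n$-vertex set $V$, let $C^{(t)}$ be the set of all unordered pairs of distinct vertices for every $t$, let the energy be $\mathcal{E}^{(t)}(u,v)=\min\{d_{G^{(t)}}(u),d_{G^{(t)}}(v)\}$, and let the thresholds satisfy $\alpha\le\beta$ with $\beta\ge n$ ($\alpha$ arbitrary otherwise). Then no edge is ever created, i.e. $E^{(t+1)}\subseteq E^{(t)}$ for all $t$, and the process coincides with the $\alpha$-core peeling: there is $T$ such that for all $t\ge T$, $G^{(t)}$ consists of the $\alpha$-core $H$ of $G^{(0)}$ together with all vertices of the $(\alpha-1)$-crust $V\setminus V(H)$ as isolated vertices.
   Context: Threshold network process: $V$ is a fixed finite vertex set, $G^{(t)}=(V,E^{(t)})$ is a simple undirected graph for $t=0,1,2,\dots$, and $d_G(u)$ is the degree of $u$ in $G$. Given thresholds $\alpha\le\beta$, interaction sets $C^{(t)}$ of unordered pairs and energies $\mathcal{E}^{(t)}(u,v)$, $G^{(t+1)}$ is obtained from $G^{(t)}$ as follows: for each $\{u,v\}\in C^{(t)}$, if $\mathcal{E}^{(t)}(u,v)<\alpha$ then $\{u,v\}\notin E^{(t+1)}$; if $\alpha\le\mathcal{E}^{(t)}(u,v)<\beta$ then its status is unchanged; if $\mathcal{E}^{(t)}(u,v)\ge\beta$ then $\{u,v\}\in E^{(t+1)}$; pairs not in $C^{(t)}$ keep their status. The $\alpha$-core of a graph $G$ is the unique maximal subgraph $H$ of $G$ in which every vertex has degree at least $\alpha$ in $H$ (possibly empty); the vertices of $G$ not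 in $H$ form the $(\alpha-1)$-crust of $G$. -}

module Defs where

open import Data.Bool using (Bool; true; false; if_then_else_)
open import Data.Nat using (ℕ; zero; suc; _+_; _⊓_)
open import Data.Fin using (Fin; _≟_)
open import Data.List using (List; map; allFin)
open import Data.Nat.ListAction using (sum)
open import Data.Integer using (ℤ; +_; _≤_; _<?_; _≤?_)
open import Data.Product using (_×_)
open import Relation.Nullary using (does)
open import Relation.Binary.PropositionalEquality using (_≡_)

Adj : ℕ → Set
Adj n = Fin n → Fin n → Bool

Symmetric : ∀ {n} → Adj n → Set
Symmetric A = ∀ u v → A u v ≡ A v u

Irreflexive : ∀ {n} → Adj n → Set
Irreflexive A = ∀ u → A u u ≡ false

IsSimpleGraph : ∀ {n} → Adj n → Set
IsSimpleGraph A = Symmetric A × Irreflexive A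

deg : ∀ {n} → Adj n → Fin n → ℕ
deg {n} A u = sum (map (λ v → if A u v then 1 else 0) (allFin n))

energy : ∀ {n} → Adj n → Fin n → Fin n → ℕ
energy A u v = deg A u ⊓ deg A v

-- One step of the threshold process with C = all pairs of distinct vertices.
-- Pairs {u,u} are not in C, so they keep their status.
step : ∀ {n} → ℤ → ℤ → Adj n → Adj n
step α β A u v with does (u ≟ v)
... | true  = A u v
... | false with does ((+ energy A u v) <? α)
...   | true  = false
...   | false with does (β ≤? (+ energy A u v))
...     | true  = true
...     | false = A u v

process : ∀ {n} → ℤ → ℤ → Adj n → ℕ → Adj n
process α β A zero    = A
process α β A (suc t) = step α β (process α β A t)

record Subgraph (n : ℕ) : Set where
  field
    verts : Fin n → Bool
    edges : Adj n
open Subgraph public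

IsSubgraphOf : ∀ {n} → Subgraph n → Adj n → Set
IsSubgraphOf H G =
  Symmetric (edges H) ×
  (∀ u v → edges H u v ≡ true → (verts H u ≡ true × verts H v ≡ true × G u v ≡ true))

_⊑_ : ∀ {n} → Subgraph n → Subgraph n → Set
H' ⊑ H = (∀ u → verts H' u ≡ true → verts H u ≡ true) ×
         (∀ u v → edges H' u v ≡ true → edges H u v ≡ true)

MinDegAtLeast : ∀ {n} → ℤ → Subgraph n → Set
MinDegAtLeast α H = ∀ u → verts H u ≡ true → α ≤ + deg (edges H) u

IsCore : ∀ {n} → ℤ → Adj n → Subgraph n → Set
IsCore α G H =
  IsSubgraphOf H G × MinDegAtLeast α H ×
  (∀ H' → IsSubgraphOf H' G → MinDegAtLeast α H' → H' ⊑ H)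

module Submission where

-- 1. In a loopless graph on n vertices every degree is < n ≤ β, so the
--    creation branch never fires: a step only deletes edges, and the
--    graphs G⁽ᵗ⁾ form a descending chain.
-- 2. A descending chain of graphs on Fin n stabilises, because the total
--    degree is a natural-number potential that drops strictly whenever the
--    graph changes; once a step fixes G⁽ᵀ⁾ = F, all later graphs equal F.
-- 3. In a fixed point F every edge has energy ≥ α, so both its ends have
--    F-degree ≥ α.  Let H have the vertices of F-degree ≥ α and the edges
--    of F; vertices outside H are then isolated in F.
-- 4. A subgraph of G⁽⁰⁾ with minimum degree ≥ α survives every step, as
--    each of its edges has energy ≥ α.  So it lies inside H: H is the α-core.

open import Defs
open import Data.Bool using (Bool; true; false; if_then_else_)
open import Data.Nat using (ℕ; zero; suc; _+_; _*_; _∸_; _⊓_; _≤_; _<_; z≤n)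
import Data.Nat.Properties as ℕ
open import Data.Fin using (Fin; _≟_)
open import Data.Integer using (ℤ; +_; +≤+; +<+)
  renaming (_≤_ to _≤ℤ_; _<_ to _<ℤ_; _≤?_ to _≤ℤ?_; _<?_ to _<ℤ?_)
import Data.Integer.Properties as ℤ
open import Data.List using (List; []; _∷_; map; allFin; length)
open import Data.List.Properties using (map-cong; length-tabulate)
open import Data.List.Membership.Propositional.Properties using (∈-allFin)
open import Data.List.Relation.Unary.All as All using (All; []; _∷_)
open import Data.Nat.ListAction using (sum)
open import Data.Product using (_×_; _,_; proj₁; proj₂; ∃-syntax)
open import Data.Sum using (_⊎_; inj₁; inj₂)
open import Function using (id; case_of_)
open import Relation.Nullary using (¬_; Dec; yes; no; does; proof; Reflects; invert)
open import Relation.Nullary.Decidable using (dec-true)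
open import Relation.Binary.PropositionalEquality
  using (_≡_; refl; sym; trans; cong; cong₂; subst; module ≡-Reasoning)
open ≡-Reasoning

sum-mono : ∀ {X : Set} {f g : X → ℕ} (xs : List X) → (∀ x → f x ≤ g x) →
  sum (map f xs) ≤ sum (map g xs)
sum-mono []       f≤g = z≤n
sum-mono (x ∷ xs) f≤g = ℕ.+-mono-≤ (f≤g x) (sum-mono xs f≤g)

-- Pointwise smaller terms either agree everywhere or have a strictly smaller
-- sum; this turns "the graph changed" into "the potential dropped".
sum-≡-or-< : ∀ {X : Set} {f g : X → ℕ} (xs : List X) → (∀ x → f x ≤ g x) →
  All (λ x → f x ≡ g x) xs ⊎ sum (map f xs) < sum (map g xs)
sum-≡-or-< []       f≤g = inj₁ []
sum-≡-or-< (x ∷ xs) f≤g with ℕ.m≤n⇒m<n∨m≡n (f≤g x) | sum-≡-or-< xs f≤g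
... | inj₁ fx<gx | _          = inj₂ (ℕ.+-mono-<-≤ fx<gx (sum-mono xs f≤g))
... | inj₂ fx≡gx | inj₁ equal = inj₁ (fx≡gx ∷ equal)
... | inj₂ fx≡gx | inj₂ less  = inj₂ (ℕ.+-mono-≤-< (ℕ.≤-reflexive fx≡gx) less)

sum-const : ∀ {X : Set} (c : ℕ) (xs : List X) → sum (map (λ _ → c) xs) ≡ length xs * c
sum-const c []       = refl
sum-const c (x ∷ xs) = cong (_+_ c) (sum-const c xs)

sum-const-allFin : ∀ n c → sum (map (λ (_ : Fin n) → c) (allFin n)) ≡ n * c
sum-const-allFin n c = trans (sum-const c (allFin n)) (cong (_* c) (length-tabulate {n = n} id))

indicator : Bool → ℕ
indicator b = if b then 1 else 0

indicator-mono : ∀ {a b} → (a ≡ true → b ≡ true) → indicator a ≤ indicator b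
indicator-mono {false} a⇒b = z≤n
indicator-mono {true}  a⇒b rewrite a⇒b refl = ℕ.≤-refl

indicator-injective : ∀ {a b} → indicator a ≡ indicator b → a ≡ b
indicator-injective {false} {false} _ = refl
indicator-injective {true}  {true}  _ = refl

does-true⇒ : ∀ {P : Set} (d : Dec P) → does d ≡ true → P
does-true⇒ {P} d does≡true = invert (subst (Reflects P) does≡true (proof d))

module _ {n : ℕ} where

  _⊆_ : Adj n → Adj n → Set
  B ⊆ A = ∀ u v → B u v ≡ true → A u v ≡ true

  _≐_ : Adj n → Adj n → Set
  B ≐ A = ∀ u v → B u v ≡ A u v

  deg-mono : {A B : Adj n} → B ⊆ A → ∀ u → deg B u ≤ deg A u
  deg-mono B⊆A u = sum-mono (allFin n) (λ v → indicator-mono (B⊆A u v))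

  deg-cong : {A B : Adj n} (u : Fin n) → (∀ v → B u v ≡ A u v) → deg B u ≡ deg A u
  deg-cong u same = cong sum (map-cong (λ v → cong indicator (same v)) (allFin n))

  energy-cong : {A B : Adj n} → B ≐ A → ∀ u v → energy B u v ≡ energy A u v
  energy-cong {A} {B} B≐A u v =
    cong₂ _⊓_ (deg-cong {A = A} {B = B} u (B≐A u)) (deg-cong {A = A} {B = B} v (B≐A v))

  deg-isolated : (A : Adj n) (u : Fin n) → (∀ v → A u v ≡ false) → deg A u ≡ 0
  deg-isolated A u isolated = begin
    deg A u                         ≡⟨ cong sum (map-cong (λ v → cong indicator (isolated v)) (allFin n)) ⟩
    sum (map (λ _ → 0) (allFin n))  ≡⟨ sum-const-allFin n 0 ⟩
    n * 0                           ≡⟨ ℕ.*-zeroʳ n ⟩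
    0                               ∎

  deg-loopless-< : (A : Adj n) (u : Fin n) → A u u ≡ false → deg A u < n
  deg-loopless-< A u no-loop
    with sum-≡-or-< (allFin n) (λ v → indicator-mono {A u v} {true} (λ _ → refl))
  ... | inj₁ all-ones =
    case trans (cong indicator (sym no-loop)) (All.lookup all-ones (∈-allFin u)) of λ ()
  ... | inj₂ deg<n    = subst (deg A u <_) (trans (sum-const-allFin n 1) (ℕ.*-identityʳ n)) deg<n

  deg-≡⇒same-row : {A B : Adj n} → B ⊆ A → ∀ u → deg B u ≡ deg A u → ∀ v → B u v ≡ A u v
  deg-≡⇒same-row {A} {B} B⊆A u deg≡ v
    with sum-≡-or-< (allFin n) (λ w → indicator-mono {B u w} {A u w} (B⊆A u w))
  ... | inj₁ rows-equal = indicator-injective (All.lookup rows-equal (∈-allFin v))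
  ... | inj₂ deg<       = case ℕ.<-irrefl deg≡ deg< of λ ()

  subgraph-edges : {H : Subgraph n} {A : Adj n} → IsSubgraphOf H A → edges H ⊆ A
  subgraph-edges (_ , inside) u v edge = proj₂ (proj₂ (inside u v edge))

  potential : Adj n → ℕ
  potential A = sum (map (deg A) (allFin n))

  potential-drops : {A B : Adj n} → B ⊆ A → B ≐ A ⊎ potential B < potential A
  potential-drops {A} {B} B⊆A with sum-≡-or-< (allFin n) (deg-mono B⊆A)
  ... | inj₁ degs-equal = inj₁ λ u → deg-≡⇒same-row B⊆A u (All.lookup degs-equal (∈-allFin u))
  ... | inj₂ smaller    = inj₂ smaller

  descending-stabilises : (G : ℕ → Adj n) → (∀ t → G (suc t) ⊆ G t) → ∃[ T ] G (suc T) ≐ G T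
  descending-stabilises G descending = search (suc (potential (G 0))) 0 ℕ.≤-refl
    where
    search : ∀ fuel t → potential (G t) < fuel → ∃[ T ] G (suc T) ≐ G T
    search zero       t ()
    search (suc fuel) t bounded with potential-drops (descending t)
    ... | inj₁ unchanged = t , unchanged
    ... | inj₂ dropped   = search fuel (suc t) (ℕ.<-≤-trans dropped (ℕ.≤-pred bounded))

≤-⊓⁺ : ∀ {α : ℤ} a b → α ≤ℤ + a → α ≤ℤ + b → α ≤ℤ + (a ⊓ b)
≤-⊓⁺ a b α≤a α≤b with ℕ.⊓-sel a b
... | inj₁ a⊓b≡a rewrite a⊓b≡a = α≤a
... | inj₂ a⊓b≡b rewrite a⊓b≡b = α≤b

≤-⊓⁻ : ∀ {α : ℤ} a b → α ≤ℤ + (a ⊓ b) → α ≤ℤ + a × α ≤ℤ + b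
≤-⊓⁻ a b α≤a⊓b = ℤ.≤-trans α≤a⊓b (+≤+ (ℕ.m⊓n≤m a b)) , ℤ.≤-trans α≤a⊓b (+≤+ (ℕ.m⊓n≤n a b))

module _ (α β : ℤ) where

  rule : ℕ → Bool → Bool
  rule e b with does ((+ e) <ℤ? α)
  ... | true  = false
  ... | false with does (β ≤ℤ? (+ e))
  ...   | true  = true
  ...   | false = b

  rule-no-creation : ∀ e b → + e <ℤ β → rule e b ≡ true → b ≡ true
  rule-no-creation e b e<β kept with (+ e) <ℤ? α
  ... | yes _ = case kept of λ ()
  ... | no  _ with β ≤ℤ? (+ e)
  ...   | yes β≤e = case ℤ.<⇒≱ e<β β≤e of λ ()
  ...   | no  _   = kept

  rule-keeps : ∀ e b → b ≡ true → α ≤ℤ + e → rule e b ≡ true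
  rule-keeps e b edge α≤e with (+ e) <ℤ? α
  ... | yes e<α = case ℤ.<⇒≱ e<α α≤e of λ ()
  ... | no  _ with β ≤ℤ? (+ e)
  ...   | yes _ = refl
  ...   | no  _ = edge

  rule-energy : ∀ e b → rule e b ≡ true → α ≤ℤ + e
  rule-energy e b edge with (+ e) <ℤ? α
  ... | yes _   = case edge of λ ()
  ... | no  e≮α = ℤ.≮⇒≥ e≮α

  module _ {n : ℕ} where

    step-diag : (A : Adj n) (u : Fin n) → step α β A u u ≡ A u u
    step-diag A u with u ≟ u
    ... | yes _   = refl
    ... | no  u≢u = case u≢u refl of λ ()

    step-offdiag : (A : Adj n) (u v : Fin n) → ¬ u ≡ v →
      step α β A u v ≡ rule (energy A u v) (A u v)
    step-offdiag A u v u≢v with u ≟ v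
    ... | yes u≡v = case u≢v u≡v of λ ()
    ... | no  _ with (+ energy A u v) <ℤ? α
    ...   | yes _ = refl
    ...   | no  _ with β ≤ℤ? (+ energy A u v)
    ...     | yes _ = refl
    ...     | no  _ = refl

    step-no-creation : (A : Adj n) (u v : Fin n) → + energy A u v <ℤ β →
      step α β A u v ≡ true → A u v ≡ true
    step-no-creation A u v e<β edge = case u ≟ v of λ where
      (yes refl) → trans (sym (step-diag A u)) edge
      (no  u≢v)  → rule-no-creation _ _ e<β (trans (sym (step-offdiag A u v u≢v)) edge)

    step-keeps : (A : Adj n) (u v : Fin n) → A u v ≡ true → α ≤ℤ + energy A u v →
      step α β A u v ≡ true
    step-keeps A u v edge α≤e = case u ≟ v of λ where
      (yes refl) → trans (step-diag A u) edge
      (no  u≢v)  → trans (step-offdiag A u v u≢v) (rule-keeps _ _ edge α≤e)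

    step-energy : (A : Adj n) (u v : Fin n) → ¬ u ≡ v → step α β A u v ≡ true →
      α ≤ℤ + energy A u v
    step-energy A u v u≢v edge = rule-energy _ _ (trans (sym (step-offdiag A u v u≢v)) edge)

    step-cong : {A B : Adj n} → B ≐ A → step α β B ≐ step α β A
    step-cong {A} {B} B≐A u v = case u ≟ v of λ where
      (yes refl) → trans (step-diag B u) (trans (B≐A u u) (sym (step-diag A u)))
      (no  u≢v)  → begin
        step α β B u v               ≡⟨ step-offdiag B u v u≢v ⟩
        rule (energy B u v) (B u v)  ≡⟨ cong₂ rule (energy-cong B≐A u v) (B≐A u v) ⟩
        rule (energy A u v) (A u v)  ≡⟨ sym (step-offdiag A u v u≢v) ⟩
        step α β A u v               ∎

    step-symmetric : (A : Adj n) → Symmetric A → Symmetric (step α β A)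
    step-symmetric A symmetric u v = case u ≟ v of λ where
      (yes refl) → refl
      (no  u≢v)  → begin
        step α β A u v               ≡⟨ step-offdiag A u v u≢v ⟩
        rule (energy A u v) (A u v)  ≡⟨ cong₂ rule (ℕ.⊓-comm (deg A u) (deg A v)) (symmetric u v) ⟩
        rule (energy A v u) (A v u)  ≡⟨ sym (step-offdiag A v u (λ v≡u → u≢v (sym v≡u))) ⟩
        step α β A v u               ∎

    step-irreflexive : (A : Adj n) → Irreflexive A → Irreflexive (step α β A)
    step-irreflexive A loopless u = trans (step-diag A u) (loopless u)

    -- With β ≥ n a step on a loopless graph only deletes edges: every energy
    -- is a degree, hence below n.
    step-only-deletes : (A : Adj n) → Irreflexive A → + n ≤ℤ β → step α β A ⊆ A
    step-only-deletes A loopless n≤β u v =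
      step-no-creation A u v (ℤ.<-≤-trans (+<+ energy<n) n≤β)
      where
      energy<n : energy A u v < n
      energy<n = ℕ.≤-<-trans (ℕ.m⊓n≤m (deg A u) (deg A v)) (deg-loopless-< A u (loopless u))

    -- A subgraph of A with minimum degree ≥ α is still a subgraph of the next
    -- graph: each of its edges joins two vertices of A-degree ≥ α.
    dense-subgraph-survives : (A : Adj n) (H : Subgraph n) → IsSubgraphOf H A →
      MinDegAtLeast α H → IsSubgraphOf H (step α β A)
    dense-subgraph-survives A H H⊆A@(symmetric , inside) min-deg = symmetric , inside-step
      where
      α≤deg : ∀ u → verts H u ≡ true → α ≤ℤ + deg A u
      α≤deg u u∈H = ℤ.≤-trans (min-deg u u∈H) (+≤+ (deg-mono (subgraph-edges H⊆A) u))

      inside-step : ∀ u v → edges H u v ≡ true →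
        verts H u ≡ true × verts H v ≡ true × step α β A u v ≡ true
      inside-step u v edge =
        let (u∈H , v∈H , uv∈A) = inside u v edge
        in  u∈H , v∈H ,
            step-keeps A u v uv∈A (≤-⊓⁺ (deg A u) (deg A v) (α≤deg u u∈H) (α≤deg v v∈H))

coreOf : ∀ {n} → ℤ → Adj n → Subgraph n
coreOf α F = record { verts = λ u → does (α ≤ℤ? + deg F u) ; edges = F }

module _ (α β : ℤ) {n : ℕ} (F : Adj n) (fixed : step α β F ≐ F) (loopless : Irreflexive F) where

  -- Every edge of a fixed point has energy ≥ α, so both ends have degree ≥ α.
  fixed-edge-degrees : ∀ u v → F u v ≡ true → α ≤ℤ + deg F u × α ≤ℤ + deg F v
  fixed-edge-degrees u v edge = case u ≟ v of λ where
    (yes refl) → case trans (sym edge) (loopless u) of λ ()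
    (no  u≢v)  → ≤-⊓⁻ (deg F u) (deg F v) (step-energy α β F u v u≢v (trans (fixed u v) edge))

  fixed-crust-isolated : ∀ u → verts (coreOf α F) u ≡ false → deg F u ≡ 0
  fixed-crust-isolated u outside = deg-isolated F u no-edge
    where
    no-edge : ∀ v → F u v ≡ false
    no-edge v with F u v in edge
    ... | false = refl
    ... | true  =
      let inside = dec-true (α ≤ℤ? + deg F u) (proj₁ (fixed-edge-degrees u v edge))
      in  case trans (sym inside) outside of λ ()

  fixed-point-core : (G : Adj n) → Symmetric F → F ⊆ G →
    (∀ H → IsSubgraphOf H G → MinDegAtLeast α H → edges H ⊆ F) → IsCore α G (coreOf α F)
  fixed-point-core G symmetric F⊆G contains-dense = (symmetric , in-core) , min-deg , maximal
    where
    in-core : ∀ u v → F u v ≡ true →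
      verts (coreOf α F) u ≡ true × verts (coreOf α F) v ≡ true × G u v ≡ true
    in-core u v edge =
      let (α≤deg-u , α≤deg-v) = fixed-edge-degrees u v edge
      in  dec-true (α ≤ℤ? + deg F u) α≤deg-u , dec-true (α ≤ℤ? + deg F v) α≤deg-v , F⊆G u v edge

    min-deg : MinDegAtLeast α (coreOf α F)
    min-deg u = does-true⇒ (α ≤ℤ? + deg F u)

    maximal : ∀ H → IsSubgraphOf H G → MinDegAtLeast α H → H ⊑ coreOf α F
    maximal H H⊆G H-min-deg = in-verts , H⊆F
      where
      H⊆F : edges H ⊆ F
      H⊆F = contains-dense H H⊆G H-min-deg

      in-verts : ∀ u → verts H u ≡ true → verts (coreOf α F) u ≡ true
      in-verts u u∈H =
        dec-true (α ≤ℤ? + deg F u) (ℤ.≤-trans (H-min-deg u u∈H) (+≤+ (deg-mono H⊆F u)))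

module Process {n : ℕ} (α β : ℤ) (G₀ : Adj n) where

  G : ℕ → Adj n
  G = process α β G₀

  G-symmetric : Symmetric G₀ → ∀ t → Symmetric (G t)
  G-symmetric symmetric₀ zero    = symmetric₀
  G-symmetric symmetric₀ (suc t) = step-symmetric α β (G t) (G-symmetric symmetric₀ t)

  G-irreflexive : Irreflexive G₀ → ∀ t → Irreflexive (G t)
  G-irreflexive loopless₀ zero    = loopless₀
  G-irreflexive loopless₀ (suc t) = step-irreflexive α β (G t) (G-irreflexive loopless₀ t)

  G-descending : Irreflexive G₀ → + n ≤ℤ β → ∀ t → G (suc t) ⊆ G t
  G-descending loopless₀ n≤β t = step-only-deletes α β (G t) (G-irreflexive loopless₀ t) n≤β

  G-⊆-G₀ : (∀ t → G (suc t) ⊆ G t) → ∀ t → G t ⊆ G₀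
  G-⊆-G₀ descending zero    u v edge = edge
  G-⊆-G₀ descending (suc t) u v edge = G-⊆-G₀ descending t u v (descending t u v edge)

  dense-subgraph-persists : (H : Subgraph n) → IsSubgraphOf H G₀ → MinDegAtLeast α H →
    ∀ t → IsSubgraphOf H (G t)
  dense-subgraph-persists H H⊆G₀ min-deg zero    = H⊆G₀
  dense-subgraph-persists H H⊆G₀ min-deg (suc t) =
    dense-subgraph-survives α β (G t) H (dense-subgraph-persists H H⊆G₀ min-deg t) min-deg

  G-stationary : ∀ T → step α β (G T) ≐ G T → ∀ t → T ≤ t → G t ≐ G T
  G-stationary T fixed t T≤t = subst (λ s → G s ≐ G T) (ℕ.m∸n+n≡m T≤t) (after (t ∸ T))
    where
    after : ∀ k → G (k + T) ≐ G T
    after zero    u v = refl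
    after (suc k) u v = trans (step-cong α β (after k) u v) (fixed u v)

-- The process only deletes edges and settles on the α-core of G₀ with the
-- (α-1)-crust isolated.
lemma3 : (n : ℕ) (G₀ : Adj n) (α β : ℤ) →
    IsSimpleGraph G₀ →
    α ≤ℤ β →
    (+ n) ≤ℤ β →
    (∀ t u v → process α β G₀ (suc t) u v ≡ true → process α β G₀ t u v ≡ true) ×
    (∃[ H ] (IsCore α G₀ H ×
      ∃[ T ] (∀ t → T ≤ t →
        (∀ u v → process α β G₀ t u v ≡ edges H u v) ×
        (∀ u → verts H u ≡ false → deg (process α β G₀ t) u ≡ 0))))
lemma3 n G₀ α β (symmetric₀ , loopless₀) _ n≤β = descending , coreOf α F , core , T , stable
  where
  open Process α β G₀

  descending : ∀ t → G (suc t) ⊆ G t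
  descending = G-descending loopless₀ n≤β

  T : ℕ
  T = proj₁ (descending-stabilises G descending)

  F : Adj n
  F = G T

  fixed : step α β F ≐ F
  fixed = proj₂ (descending-stabilises G descending)

  core : IsCore α G₀ (coreOf α F)
  core = fixed-point-core α β F fixed (G-irreflexive loopless₀ T) G₀
    (G-symmetric symmetric₀ T) (G-⊆-G₀ descending T)
    (λ H H⊆G₀ min-deg → subgraph-edges (dense-subgraph-persists H H⊆G₀ min-deg T))

  stable : ∀ t → T ≤ t → (G t ≐ F) × (∀ u → verts (coreOf α F) u ≡ false → deg (G t) u ≡ 0)
  stable t T≤t = G-stationary T fixed t T≤t , λ u outside →
    trans (deg-cong {A = F} {B = G t} u (G-stationary T fixed t T≤t u))
          (fixed-crust-isolated α β F fixed (G-irreflexive loopless₀ T) u outside)
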